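{- Given a positive integer $r$, let $c\ge e/36$ be a constant. Suppose that $G$ is a graph on $n>18cr^3$ vertices, having at most $cn$ edges. Then $G$ is $r$-EKR.
   Context: All graphs are finite and simple. For a graph $G$, $\mathcal{I}^r(G)$ denotes the family of independent sets of $G$ of size exactly $r$, and for a vertex $v$, $s_r(v)$ denotes the number of members of $\mathcal{I}^r(G)$ containing $v$. A family of sets is intersecting if every two of its members intersect. $G$ is called $r$-EKR if, letting $\mathcal{F}\subseteq \mathcal{I}^r(G)$ be an intersecting subfamily of maximum size, some vertex $v$ satisfies $s_r(v)=|\mathcal{F}|$.
   Formalization: The constant $c$ ranges over the rationals. -}

module Defs where

open import Data.Nat using (ℕ; zero; suc; _!)
import Data.Nat as ℕ
open import Data.Nat.Properties using (_!≢0)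
open import Data.Integer using (+_)
open import Data.Rational using (ℚ; _/_; _+_; _≤_; 0ℚ)
import Data.Rational
open import Data.Bool using (Bool; true; false)
import Data.Bool.Properties as BoolP
open import Data.Fin using (Fin; toℕ)
open import Data.Fin.Properties using (all?)
open import Data.Fin.Subset using (Subset; _∈_; _∉_; ∣_∣; inside; outside)
open import Data.Fin.Subset.Properties using (_∈?_)
open import Data.Vec using (Vec; []; _∷_)
open import Data.List using (List; []; _∷_; _++_; map; length; filter; allFin; cartesianProduct)
open import Data.List.Relation.Unary.All using (All)
open import Data.List.Relation.Unary.AllPairs using (AllPairs)
open import Data.List.Relation.Unary.Unique.Propositional using (Unique)
open import Data.List.Membership.Propositional using () renaming (_∈_ to _∈L_)
open import Data.Product using (Σ; ∃; _×_; _,_; proj₁; proj₂)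
open import Relation.Binary.PropositionalEquality using (_≡_)
open import Relation.Nullary using (Dec; ¬_; ¬?)
open import Relation.Nullary.Decidable using (_×-dec_; _→-dec_)

record Graph (n : ℕ) : Set where
  field
    adj     : Fin n → Fin n → Bool
    sym     : ∀ i j → adj i j ≡ adj j i
    irrefl  : ∀ i → adj i i ≡ false
open Graph public

Adjacent : ∀ {n} → Graph n → Fin n → Fin n → Set
Adjacent G i j = adj G i j ≡ true

numEdges : ∀ {n} → Graph n → ℕ
numEdges {n} G = length (filter P? (cartesianProduct (allFin n) (allFin n)))
  where
  P? : (p : Fin n × Fin n) → Dec ((toℕ (proj₁ p) ℕ.< toℕ (proj₂ p)) × Adjacent G (proj₁ p) (proj₂ p))
  P? (i , j) = (toℕ i ℕ.<? toℕ j) ×-dec (adj G i j BoolP.≟ true)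

Independent : ∀ {n} → Graph n → Subset n → Set
Independent G S = ∀ i j → i ∈ S → j ∈ S → ¬ Adjacent G i j

IsIndepSet : ∀ {n} → Graph n → ℕ → Subset n → Set
IsIndepSet G r S = Independent G S × ∣ S ∣ ≡ r

independent? : ∀ {n} (G : Graph n) (S : Subset n) → Dec (Independent G S)
independent? G S = all? λ i → all? λ j → (i ∈? S) →-dec ((j ∈? S) →-dec (¬? (adj G i j BoolP.≟ true)))

indepSet? : ∀ {n} (G : Graph n) (r : ℕ) (S : Subset n) → Dec (IsIndepSet G r S)
indepSet? G r S = independent? G S ×-dec (∣ S ∣ ℕ.≟ r)

allSubsets : (n : ℕ) → List (Subset n)
allSubsets zero    = [] ∷ []
allSubsets (suc n) = map (outside ∷_) (allSubsets n) ++ map (inside ∷_) (allSubsets n)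

s : ∀ {n} → Graph n → ℕ → Fin n → ℕ
s {n} G r v = length (filter (λ S → indepSet? G r S ×-dec (v ∈? S)) (allSubsets n))

-- Intersecting subfamilies of 𝓘^r(G).  A family is a duplicate-free list of subsets.

Intersect : ∀ {n} → Subset n → Subset n → Set
Intersect S T = ∃ λ i → i ∈ S × i ∈ T

IsIntersectingSubfamily : ∀ {n} → Graph n → ℕ → List (Subset n) → Set
IsIntersectingSubfamily G r F = Unique F × All (IsIndepSet G r) F × AllPairs Intersect F

IsMaxIntersecting : ∀ {n} → Graph n → ℕ → List (Subset n) → Set
IsMaxIntersecting G r F =
  IsIntersectingSubfamily G r F ×
  (∀ F′ → IsIntersectingSubfamily G r F′ → length F′ ℕ.≤ length F)

EKR : ∀ {n} → ℕ → Graph n → Set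
EKR r G = ∀ F → IsMaxIntersecting G r F → ∃ λ v → s G r v ≡ length F

-- Euler's number e = Σ_{i ≥ 0} 1/i!, via its partial sums.

ePartial : ℕ → ℚ
ePartial zero    = (+ 1 / (0 !)) {{0 !≢0}}
ePartial (suc k) = ePartial k + (+ 1 / (suc k !)) {{suc k !≢0}}

-- x ≥ e/36, i.e. 36·x ≥ e = sup_k ePartial k
AtLeastEOver36 : ℚ → Set
AtLeastEOver36 x = ∀ k → ePartial k ≤ (+ 36 / 1) Data.Rational.* x

{-# OPTIONS --safe #-}
-- A maximum intersecting family that is a star at v has exactly s_r(v) members, the star at
-- v being intersecting itself.  For r = 1 every intersecting family is a star.  Otherwise let
-- r = k + 2 and B = C(n-2, k), the number of r-sets through two fixed vertices.  A non-star
-- family F has at most r²B members: each member meets a fixed A ∈ F, and the members through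
-- a vertex a meet a member avoiding a, in some b ≠ a.  The number N of independent r-sets is
-- at least C(n, r) - EB, as every dependent r-set contains one of the E edges, and some vertex
-- lies in at least rN/n of them.  Since (r-1)r·C(n, r) = n(n-1)B, this star is at least as
-- large as F once (r-1)(r²n + rE) + n ≤ n², and indeed (r-1)(r²n + rE) + n ≤ r³(n + E) ≤ n²
-- because E ≤ cn, 18cr³ < n and c ≥ e/36 > 1/17.
module Submission where

module Counting where

  open import Level using (Level)
  open import Data.Nat using (ℕ; suc; _+_; _*_; _≤_; z≤n; s≤s)
  open import Data.Nat.Properties
    using (≤-trans; *-zeroʳ; +-mono-≤; +-suc; module ≤-Reasoning)
  open import Data.Nat.ListAction using (sum)
  open import Data.List using (List; []; _∷_; [_]; _++_; map; length; filter)
  open import Data.List.Properties using (filter-++; length-++; filter-notAll; filter-≐; filter-none; map-cong)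
  open import Data.Nat.Tactic.RingSolver using (solve-∀)
  open import Function using (_∘_)
  open import Data.List.Membership.Propositional using (_∈_)
  open import Data.List.Membership.Propositional.Properties using (∈-filter⁺; ∈-filter⁻)
  open import Data.List.Relation.Unary.All as All using (All; []; _∷_)
  open import Data.List.Relation.Unary.Any as Any using (here; there)
  open import Data.List.Relation.Unary.AllPairs using (AllPairs; []; _∷_)
  open import Data.List.Relation.Unary.Unique.Propositional using (Unique)
  open import Data.List.Relation.Binary.Sublist.Propositional.Properties
    using (filter⁺; filter-⊆; length-mono-≤)
  open import Data.Product using (∃; _×_; _,_)
  open import Data.Sum using (_⊎_; inj₁; inj₂)
  open import Data.Empty using (⊥-elim)
  open import Relation.Nullary using (Dec; yes; no; ¬_; ¬?)
  open import Relation.Nullary.Decidable using (_×-dec_)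
  open import Relation.Unary using (Pred; Decidable; _≐_)
  open import Relation.Unary.Properties using (∁?)
  open import Relation.Binary.Definitions using (DecidableEquality)
  open import Relation.Binary.PropositionalEquality using (_≡_; refl; trans; cong; cong₂; module ≡-Reasoning)

  private variable
    a b p q : Level
    A : Set a
    B : Set b

  count : {P : Pred A p} → Decidable P → List A → ℕ
  count P? xs = length (filter P? xs)

  module _ {P : Pred A p} (P? : Decidable P) where

    count-++ : ∀ xs ys → count P? (xs ++ ys) ≡ count P? xs + count P? ys
    count-++ xs ys = trans (cong length (filter-++ P? xs ys)) (length-++ (filter P? xs))

    count+count-∁≡length : ∀ xs → count P? xs + count (∁? P?) xs ≡ length xs
    count+count-∁≡length [] = refl
    count+count-∁≡length (x ∷ xs) with P? x
    ... | yes _ = cong suc (count+count-∁≡length xs)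
    ... | no _ = trans (+-suc _ _) (cong suc (count+count-∁≡length xs))

    count-filter-≤ : {Q : Pred A q} (Q? : Decidable Q) (xs : List A) → count P? (filter Q? xs) ≤ count P? xs
    count-filter-≤ Q? xs = length-mono-≤ (filter⁺ P? P? (λ { refl px → px }) (filter-⊆ Q? xs))

    count-filter : {Q : Pred A q} (Q? : Decidable Q) (xs : List A) →
      count Q? (filter P? xs) ≡ count (λ x → P? x ×-dec Q? x) xs
    count-filter Q? [] = refl
    count-filter Q? (x ∷ xs) with P? x
    ... | no _ = count-filter Q? xs
    ... | yes _ with Q? x
    ...   | yes _ = cong suc (count-filter Q? xs)
    ...   | no _ = count-filter Q? xs

  count-map : {P : Pred B p} (P? : Decidable P) (f : A → B) (xs : List A) → count P? (map f xs) ≡ count (P? ∘ f) xs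
  count-map P? f [] = refl
  count-map P? f (x ∷ xs) with P? (f x)
  ... | yes _ = cong suc (count-map P? f xs)
  ... | no _ = count-map P? f xs

  count-≐ : {P : Pred A p} {Q : Pred A q} (P? : Decidable P) (Q? : Decidable Q) → P ≐ Q → ∀ xs → count P? xs ≡ count Q? xs
  count-≐ P? Q? P≐Q xs = cong length (filter-≐ P? Q? P≐Q xs)

  count-none : {P : Pred A p} (P? : Decidable P) → (∀ x → ¬ P x) → ∀ xs → count P? xs ≡ 0
  count-none P? ¬P xs = cong length (filter-none P? (All.universal ¬P xs))

  Unique⇒length≤ : DecidableEquality A → {xs : List A} (ys : List A) →
    Unique xs → (∀ {x} → x ∈ xs → x ∈ ys) → length xs ≤ length ys
  Unique⇒length≤ _≟_ {[]} ys _ _ = z≤n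
  Unique⇒length≤ _≟_ {x ∷ xs} ys (x∉xs ∷ unique) xs⊆ys = ≤-trans (s≤s ih)
      (filter-notAll (λ y → ¬? (y ≟ x)) ys (Any.map (λ { refl ¬x≢x → ¬x≢x refl }) (xs⊆ys (here refl))))
    where
    ih : length xs ≤ count (λ y → ¬? (y ≟ x)) ys
    ih = Unique⇒length≤ _≟_ _ unique λ y∈xs →
      ∈-filter⁺ (λ y → ¬? (y ≟ x)) (xs⊆ys (there y∈xs)) λ { refl → All.lookup x∉xs y∈xs refl }

  union-bound : {P : B → Pred A p} (P? : ∀ e → Decidable (P e)) (c : ℕ) (es : List B) (xs : List A) →
    (∀ {x} → x ∈ xs → ∃ λ e → e ∈ es × P e x) →
    (∀ {e} → e ∈ es → count (P? e) xs ≤ c) →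
    length xs ≤ length es * c
  union-bound P? c [] [] _ _ = z≤n
  union-bound P? c [] (x ∷ xs) covered _ with covered (here refl)
  ... | _ , () , _
  union-bound {P = P} P? c (e ∷ es) xs covered bounded = begin
    length xs                         ≡⟨ count+count-∁≡length (P? e) xs ⟨
    count (P? e) xs + length rest     ≤⟨ +-mono-≤ (bounded (here refl)) (union-bound P? c es rest covered′ bounded′) ⟩
    c + length es * c                 ∎
    where
    open ≤-Reasoning
    rest = filter (∁? (P? e)) xs
    covered′ : ∀ {x} → x ∈ rest → ∃ λ e′ → e′ ∈ es × P e′ x
    covered′ x∈rest with ∈-filter⁻ (∁? (P? e)) x∈rest
    ... | x∈xs , ¬Pex with covered x∈xs
    ...   | _ , here refl , Pex = ⊥-elim (¬Pex Pex)
    ...   | e′ , there e′∈es , Pe′x = e′ , e′∈es , Pe′x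
    bounded′ : ∀ {e′} → e′ ∈ es → count (P? e′) rest ≤ c
    bounded′ e′∈es = ≤-trans (count-filter-≤ (P? _) (∁? (P? e)) xs) (bounded (there e′∈es))

  sum-map-+ : (f g : A → ℕ) (xs : List A) →
    sum (map (λ x → f x + g x) xs) ≡ sum (map f xs) + sum (map g xs)
  sum-map-+ f g [] = refl
  sum-map-+ f g (x ∷ xs) rewrite sum-map-+ f g xs = +-interchange (f x) (g x) _ _
    where
    +-interchange : ∀ a b c d → (a + b) + (c + d) ≡ (a + c) + (b + d)
    +-interchange = solve-∀

  sum-map-≤ : (f : A → ℕ) {c : ℕ} (xs : List A) → (∀ {x} → x ∈ xs → f x ≤ c) → sum (map f xs) ≤ length xs * c
  sum-map-≤ f [] _ = z≤n
  sum-map-≤ f (x ∷ xs) f≤c = +-mono-≤ (f≤c (here refl)) (sum-map-≤ f xs (f≤c ∘ there))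

  sum-map-const : (f : A → ℕ) {c : ℕ} {xs : List A} → All (λ x → f x ≡ c) xs → sum (map f xs) ≡ length xs * c
  sum-map-const f [] = refl
  sum-map-const f (fx≡c ∷ f≡c) = cong₂ _+_ fx≡c (sum-map-const f f≡c)

  sum-map-count-singleton : {R : A → B → Set q} (R? : ∀ x y → Dec (R x y)) (x : A) (ys : List B) →
    sum (map (λ y → count (λ x′ → R? x′ y) [ x ]) ys) ≡ count (R? x) ys
  sum-map-count-singleton R? x [] = refl
  sum-map-count-singleton R? x (y ∷ ys) with R? x y
  ... | yes _ = cong suc (sum-map-count-singleton R? x ys)
  ... | no _ = sum-map-count-singleton R? x ys

  double-count : {R : A → B → Set q} (R? : ∀ x y → Dec (R x y)) (xs : List A) (ys : List B) →
    sum (map (λ y → count (λ x → R? x y) xs) ys) ≡ sum (map (λ x → count (R? x) ys) xs)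
  double-count R? [] ys = trans (sum-map-const (λ _ → 0) (All.universal (λ _ → refl) ys)) (*-zeroʳ (length ys))
  double-count R? (x ∷ xs) ys = begin
    sum (map (λ y → count (λ x′ → R? x′ y) (x ∷ xs)) ys)
      ≡⟨ cong sum (map-cong (λ y → count-++ (λ x′ → R? x′ y) [ x ] xs) ys) ⟩
    sum (map (λ y → count (λ x′ → R? x′ y) [ x ] + count (λ x′ → R? x′ y) xs) ys)
      ≡⟨ sum-map-+ (λ y → count (λ x′ → R? x′ y) [ x ]) _ ys ⟩
    sum (map (λ y → count (λ x′ → R? x′ y) [ x ]) ys) + sum (map (λ y → count (λ x′ → R? x′ y) xs) ys)
      ≡⟨ cong₂ _+_ (sum-map-count-singleton R? x ys) (double-count R? xs ys) ⟩
    count (R? x) ys + sum (map (λ x′ → count (R? x′) ys) xs) ∎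
    where open ≡-Reasoning

  AllPairs-lookup : {R : A → A → Set q} {xs : List A} → AllPairs R xs →
    ∀ {x y} → x ∈ xs → y ∈ xs → x ≡ y ⊎ R x y ⊎ R y x
  AllPairs-lookup (_ ∷ _) (here refl) (here refl) = inj₁ refl
  AllPairs-lookup (Rx ∷ _) (here refl) (there y∈) = inj₂ (inj₁ (All.lookup Rx y∈))
  AllPairs-lookup (Rx ∷ _) (there x∈) (here refl) = inj₂ (inj₂ (All.lookup Rx x∈))
  AllPairs-lookup (_ ∷ R*) (there x∈) (there y∈) = AllPairs-lookup R* x∈ y∈

  All⇒AllPairs : {P : Pred A p} {R : A → A → Set q} → (∀ {x y} → P x → P y → R x y) →
    ∀ {xs} → All P xs → AllPairs R xs
  All⇒AllPairs P⇒R [] = []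
  All⇒AllPairs P⇒R (px ∷ pxs) = All.map (P⇒R px) pxs ∷ All⇒AllPairs P⇒R pxs

module Subsets where

  open Counting
  open import Defs using (allSubsets)
  open import Data.Nat using (ℕ; zero; suc; _+_; _∸_; _≤_; _<_; _≟_; s≤s)
  open import Data.Nat.Properties using (>⇒≢; suc-injective; +-suc; +-comm; +-∸-assoc; <-irrefl; +-identityʳ)
  open import Data.Nat.Combinatorics using (_C_; nCk+nC[k+1]≡[n+1]C[k+1])
  open import Data.Fin using (Fin; zero; suc)
  import Data.Fin
  open import Data.Fin.Subset using (Subset; Nonempty; _∈_; _∉_; _⊆_; ∣_∣; inside; outside; ⊥; ⁅_⁆; _∪_)
  open import Data.Fin.Subset.Properties
    using (_∈?_; _⊆?_; drop-there; drop-∷-⊆; p⊆q⇒∣p∣≤∣q∣; ∣p∣≤n; ∉⊥; ∣⊥∣≡0; ∣⁅x⁆∣≡1; x∈⁅y⁆⇒x≡y;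
           x∈p∪q⁻; ∪-identityˡ; ∪-identityʳ; nonempty?; Empty-unique)
  open import Data.Vec using ([]; _∷_; here; there)
  open import Data.Vec.Properties using (≡-dec)
  import Data.Bool.Properties as Bool
  open import Data.List using (List; []; _∷_; map; allFin; filter; length)
  open import Data.List.Properties using (map-tabulate)
  open import Data.List.Membership.Propositional using () renaming (_∈_ to _∈ₗ_)
  open import Data.List.Membership.Propositional.Properties
    using (∈-++⁺ˡ; ∈-++⁺ʳ; ∈-map⁺; ∈-map⁻; ∈-filter⁺; ∈-allFin)
  open import Data.List.Relation.Unary.Any using (here)
  import Data.List.Relation.Unary.All as All
  open import Data.List.Relation.Unary.Unique.Propositional using (Unique; []; _∷_)
  import Data.List.Relation.Unary.Unique.Propositional.Properties as Unique
  open import Data.Product using (_×_; _,_)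
  open import Data.Sum using (inj₁; inj₂)
  open import Data.Empty using (⊥-elim)
  open import Function using (_∘_; id)
  open import Relation.Nullary using (¬_; yes; no; contradiction)
  open import Relation.Nullary.Decidable using (_×-dec_)
  open import Relation.Unary using (Decidable)
  open import Relation.Binary.PropositionalEquality using (_≡_; _≢_; refl; sym; trans; cong; cong₂; subst; module ≡-Reasoning)

  private variable
    n : ℕ

  ∈-allSubsets : (S : Subset n) → S ∈ₗ allSubsets n
  ∈-allSubsets [] = here refl
  ∈-allSubsets {suc n} (outside ∷ S) = ∈-++⁺ˡ (∈-map⁺ (outside ∷_) (∈-allSubsets S))
  ∈-allSubsets {suc n} (inside ∷ S) = ∈-++⁺ʳ (map (outside ∷_) (allSubsets n)) (∈-map⁺ (inside ∷_) (∈-allSubsets S))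

  allSubsets-unique : ∀ n → Unique (allSubsets n)
  allSubsets-unique zero = All.[] ∷ []
  allSubsets-unique (suc n) = Unique.++⁺ (Unique.map⁺ ∷-injectiveʳ (allSubsets-unique n))
    (Unique.map⁺ ∷-injectiveʳ (allSubsets-unique n)) disjoint
    where
    ∷-injectiveʳ : ∀ {s} {S T : Subset n} → s ∷ S ≡ s ∷ T → S ≡ T
    ∷-injectiveʳ refl = refl
    disjoint : ∀ {S} → ¬ (S ∈ₗ map (outside ∷_) (allSubsets n) × S ∈ₗ map (inside ∷_) (allSubsets n))
    disjoint (out , in′) with ∈-map⁻ (outside ∷_) out | ∈-map⁻ (inside ∷_) in′
    ... | _ , _ , refl | _ , _ , ()

  #_ : ∀ {p} {P : Subset n → Set p} → Decidable P → ℕ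
  #_ {n} P? = count P? (allSubsets n)

  #-suc : ∀ {p} {P : Subset (suc n) → Set p} (P? : Decidable P) →
    # P? ≡ # (P? ∘ (outside ∷_)) + # (P? ∘ (inside ∷_))
  #-suc {n} P? = trans (count-++ P? (map (outside ∷_) (allSubsets n)) _)
    (cong₂ _+_ (count-map P? (outside ∷_) (allSubsets n)) (count-map P? (inside ∷_) (allSubsets n)))

  elements : Subset n → List (Fin n)
  elements {n} S = filter (_∈? S) (allFin n)

  ∈-elements : ∀ {x} {S : Subset n} → x ∈ S → x ∈ₗ elements S
  ∈-elements {x = x} {S} x∈S = ∈-filter⁺ (_∈? S) (∈-allFin x) x∈S

  length-elements : (S : Subset n) → length (elements S) ≡ ∣ S ∣
  length-elements [] = refl
  length-elements {suc n} (s ∷ S) = trans (cong (count (_∈? (s ∷ S)) ∘ (zero ∷_)) (sym (map-tabulate id suc))) (head-case s)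
    where
    tail-count : ∀ s → count (_∈? (s ∷ S)) (map suc (allFin n)) ≡ ∣ S ∣
    tail-count s = trans (count-map (_∈? (s ∷ S)) suc (allFin n))
      (trans (count-≐ _ (_∈? S) (drop-there , there) (allFin n)) (length-elements S))
    head-case : ∀ s → count (_∈? (s ∷ S)) (zero ∷ map suc (allFin n)) ≡ ∣ s ∷ S ∣
    head-case inside = cong suc (tail-count inside)
    head-case outside = tail-count outside

  Superset : Subset n → ℕ → Subset n → Set
  Superset R m S = ∣ S ∣ ≡ m × R ⊆ S

  superset? : (R : Subset n) (m : ℕ) → Decidable (Superset R m)
  superset? R m S = (∣ S ∣ ≟ m) ×-dec (R ⊆? S)

  outside-⊆ : ∀ {s} {R S : Subset n} → R ⊆ S → outside ∷ R ⊆ s ∷ S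
  outside-⊆ R⊆S (there x∈R) = there (R⊆S x∈R)

  #supersets-outside : (R : Subset n) (m : ℕ) →
    # (superset? (outside ∷ R) m ∘ (outside ∷_)) ≡ # (superset? R m)
  #supersets-outside {n} R m =
    count-≐ (superset? (outside ∷ R) m ∘ (outside ∷_)) (superset? R m)
      ((λ (eq , ⊆) → eq , drop-∷-⊆ ⊆) , (λ (eq , ⊆) → eq , outside-⊆ ⊆)) (allSubsets n)

  #supersets-inside : ∀ s (R : Subset n) (m : ℕ) →
    # (superset? (s ∷ R) (suc m) ∘ (inside ∷_)) ≡ # (superset? R m)
  #supersets-inside {n} s R m =
    count-≐ (superset? (s ∷ R) (suc m) ∘ (inside ∷_)) (superset? R m)
      ((λ (eq , ⊆) → suc-injective eq , drop-∷-⊆ ⊆) , (λ (eq , ⊆) → cong suc eq , grow ⊆)) (allSubsets n)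
    where
    grow : ∀ {S} → R ⊆ S → s ∷ R ⊆ inside ∷ S
    grow R⊆S here = here
    grow R⊆S (there x∈R) = there (R⊆S x∈R)

  #supersets : ∀ n (R : Subset n) k → # (superset? R (k + ∣ R ∣)) ≡ (n ∸ ∣ R ∣) C k
  #supersets zero [] zero = refl
  #supersets zero [] (suc k) = refl
  #supersets (suc n) (outside ∷ R) zero = begin
    # (superset? (outside ∷ R) ∣ R ∣)
      ≡⟨ #-suc (superset? (outside ∷ R) ∣ R ∣) ⟩
    # (superset? (outside ∷ R) ∣ R ∣ ∘ (outside ∷_)) + # (superset? (outside ∷ R) ∣ R ∣ ∘ (inside ∷_))
      ≡⟨ cong₂ _+_ (#supersets-outside R ∣ R ∣) (count-none _ too-large (allSubsets n)) ⟩
    # (superset? R ∣ R ∣) + 0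
      ≡⟨ trans (+-identityʳ _) (#supersets n R zero) ⟩
    1 ∎
    where
    open ≡-Reasoning
    too-large : ∀ S → ¬ Superset (outside ∷ R) ∣ R ∣ (inside ∷ S)
    too-large S (eq , ⊆) = <-irrefl refl (subst (_≤ ∣ S ∣) (sym eq) (p⊆q⇒∣p∣≤∣q∣ (drop-∷-⊆ ⊆)))
  #supersets (suc n) (outside ∷ R) (suc k) = begin
    # (superset? (outside ∷ R) (suc k + ∣ R ∣))
      ≡⟨ #-suc (superset? (outside ∷ R) (suc k + ∣ R ∣)) ⟩
    # (superset? (outside ∷ R) (suc k + ∣ R ∣) ∘ (outside ∷_))
      + # (superset? (outside ∷ R) (suc k + ∣ R ∣) ∘ (inside ∷_))
      ≡⟨ cong₂ _+_ (trans (#supersets-outside R _) (#supersets n R (suc k)))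
                   (trans (#supersets-inside outside R _) (#supersets n R k)) ⟩
    (n ∸ ∣ R ∣) C suc k + (n ∸ ∣ R ∣) C k
      ≡⟨ trans (+-comm ((n ∸ ∣ R ∣) C suc k) _) (nCk+nC[k+1]≡[n+1]C[k+1] (n ∸ ∣ R ∣) k) ⟩
    suc (n ∸ ∣ R ∣) C suc k
      ≡⟨ cong (_C suc k) (+-∸-assoc 1 (∣p∣≤n R)) ⟨
    (suc n ∸ ∣ R ∣) C suc k ∎
    where open ≡-Reasoning
  #supersets (suc n) (inside ∷ R) k = begin
    # (superset? (inside ∷ R) (k + suc ∣ R ∣))
      ≡⟨ cong (λ m → # (superset? (inside ∷ R) m)) (+-suc k ∣ R ∣) ⟩
    # (superset? (inside ∷ R) (suc (k + ∣ R ∣)))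
      ≡⟨ #-suc (superset? (inside ∷ R) (suc (k + ∣ R ∣))) ⟩
    # (superset? (inside ∷ R) (suc (k + ∣ R ∣)) ∘ (outside ∷_))
      + # (superset? (inside ∷ R) (suc (k + ∣ R ∣)) ∘ (inside ∷_))
      ≡⟨ cong₂ _+_ (count-none _ (λ { S (_ , ⊆) → zero∉ (⊆ here) }) (allSubsets n)) (#supersets-inside inside R _) ⟩
    # (superset? R (k + ∣ R ∣))
      ≡⟨ #supersets n R k ⟩
    (n ∸ ∣ R ∣) C k ∎
    where
    open ≡-Reasoning
    zero∉ : ∀ {S : Subset n} → zero ∉ outside ∷ S
    zero∉ ()

  pair : Fin n → Fin n → Subset n
  pair a b = ⁅ a ⁆ ∪ ⁅ b ⁆

  ∣pair∣≡2 : {a b : Fin n} → a ≢ b → ∣ pair a b ∣ ≡ 2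
  ∣pair∣≡2 {a = zero} {zero} a≢b = ⊥-elim (a≢b refl)
  ∣pair∣≡2 {a = zero} {suc b} _ = cong suc (trans (cong ∣_∣ (∪-identityˡ ⁅ b ⁆)) (∣⁅x⁆∣≡1 b))
  ∣pair∣≡2 {a = suc a} {zero} _ = cong suc (trans (cong ∣_∣ (∪-identityʳ ⁅ a ⁆)) (∣⁅x⁆∣≡1 a))
  ∣pair∣≡2 {a = suc a} {suc b} a≢b = ∣pair∣≡2 (a≢b ∘ cong suc)

  pair⊆ : ∀ {a b : Fin n} {S} → a ∈ S → b ∈ S → pair a b ⊆ S
  pair⊆ {a = a} {b} a∈S b∈S x∈ with x∈p∪q⁻ ⁅ a ⁆ ⁅ b ⁆ x∈
  ... | inj₁ x∈⁅a⁆ = subst (_∈ _) (sym (x∈⁅y⁆⇒x≡y a x∈⁅a⁆)) a∈S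
  ... | inj₂ x∈⁅b⁆ = subst (_∈ _) (sym (x∈⁅y⁆⇒x≡y b x∈⁅b⁆)) b∈S

  #supersets-pair : ∀ n k {a b : Fin n} → a ≢ b →
    # (superset? (pair a b) (k + 2)) ≡ (n ∸ 2) C k
  #supersets-pair n k {a} {b} a≢b =
    subst (λ m → # (superset? (pair a b) (k + m)) ≡ (n ∸ m) C k) (∣pair∣≡2 a≢b)
      (#supersets n (pair a b) k)

  Unique⇒length≤# : ∀ {p} {P : Subset n → Set p} (P? : Decidable P) {Fs : List (Subset n)} →
    Unique Fs → All.All P Fs → length Fs ≤ # P?
  Unique⇒length≤# {n} P? unique all-P =
    Unique⇒length≤ (≡-dec Bool._≟_) _ unique λ {S} S∈Fs → ∈-filter⁺ P? (∈-allSubsets S) (All.lookup all-P S∈Fs)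

  #size≡C : ∀ n m → # (λ (S : Subset n) → ∣ S ∣ ≟ m) ≡ n C m
  #size≡C n m = begin
    # (λ (S : Subset n) → ∣ S ∣ ≟ m)
      ≡⟨ count-≐ (λ S → ∣ S ∣ ≟ m) (superset? ⊥ (m + ∣ ⊥ {n} ∣))
           ((λ eq → trans eq m≡m+∣⊥∣ , λ x∈⊥ → ⊥-elim (∉⊥ x∈⊥)) , λ (eq , _) → trans eq (sym m≡m+∣⊥∣))
           (allSubsets n) ⟩
    # (superset? (⊥ {n}) (m + ∣ ⊥ {n} ∣))
      ≡⟨ #supersets n ⊥ m ⟩
    (n ∸ ∣ ⊥ {n} ∣) C m
      ≡⟨ cong (λ j → (n ∸ j) C m) (∣⊥∣≡0 n) ⟩
    n C m ∎
    where
    open ≡-Reasoning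
    m≡m+∣⊥∣ : m ≡ m + ∣ ⊥ {n} ∣
    m≡m+∣⊥∣ = sym (trans (cong (m +_) (∣⊥∣≡0 n)) (+-identityʳ m))

  0<∣S∣⇒Nonempty : {S : Subset n} → 0 < ∣ S ∣ → Nonempty S
  0<∣S∣⇒Nonempty {n} {S} 0<∣S∣ with nonempty? S
  ... | yes nonempty = nonempty
  ... | no empty = contradiction (trans (cong ∣_∣ (Empty-unique {p = S} empty)) (∣⊥∣≡0 n)) (>⇒≢ 0<∣S∣)

  ∣S∣≡1⇒∈-unique : ∀ {S : Subset n} {a b} → ∣ S ∣ ≡ 1 → a ∈ S → b ∈ S → a ≡ b
  ∣S∣≡1⇒∈-unique {S = S} {a} {b} ∣S∣≡1 a∈S b∈S with a Data.Fin.≟ b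
  ... | yes a≡b = a≡b
  ... | no a≢b = contradiction (subst (2 ≤_) ∣S∣≡1 2≤∣S∣) λ { (s≤s ()) }
    where
    2≤∣S∣ : 2 ≤ ∣ S ∣
    2≤∣S∣ = subst (_≤ ∣ S ∣) (∣pair∣≡2 a≢b) (p⊆q⇒∣p∣≤∣q∣ (pair⊆ a∈S b∈S))

module Binomial where

  open import Data.Nat using (zero; suc; _+_; _*_; _∸_)
  open import Data.Nat.Properties using (*-zeroʳ; *-identityʳ; *-distribˡ-+; *-assoc; +-identityʳ)
  open import Data.Nat.Combinatorics using (_C_; nC1≡n; nCk+nC[k+1]≡[n+1]C[k+1])
  open import Data.Nat.Tactic.RingSolver using (solve-∀)
  open import Relation.Binary.PropositionalEquality using (_≡_; refl; sym; trans; cong; cong₂; module ≡-Reasoning)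

  C-absorption : ∀ n k → suc k * (suc n C suc k) ≡ suc n * (n C k)
  C-absorption zero zero = refl
  C-absorption zero (suc k) = *-zeroʳ (suc (suc k))
  C-absorption (suc n) zero = trans (+-identityʳ _) (trans (nC1≡n (suc (suc n))) (sym (*-identityʳ (suc (suc n)))))
  C-absorption (suc n) (suc k) = begin
    suc (suc k) * (suc (suc n) C suc (suc k))
      ≡⟨ cong (suc (suc k) *_) (nCk+nC[k+1]≡[n+1]C[k+1] (suc n) (suc k)) ⟨
    suc (suc k) * (X + Y)
      ≡⟨ *-distribˡ-+ (suc (suc k)) X Y ⟩
    X + suc k * X + suc (suc k) * Y
      ≡⟨ cong₂ (λ a b → X + a + b) (C-absorption n k) (C-absorption n (suc k)) ⟩
    X + suc n * (n C k) + suc n * (n C suc k)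
      ≡⟨ regroup X (suc n) (n C k) (n C suc k) ⟩
    X + suc n * (n C k + n C suc k)
      ≡⟨ cong (λ y → X + suc n * y) (nCk+nC[k+1]≡[n+1]C[k+1] n k) ⟩
    suc (suc n) * X ∎
    where
    open ≡-Reasoning
    X = suc n C suc k
    Y = suc n C suc (suc k)
    regroup : ∀ x m a b → x + m * a + m * b ≡ x + m * (a + b)
    regroup = solve-∀

  C-double-absorption : ∀ n k → suc k * (suc (suc k) * (n C suc (suc k))) ≡ n * (n ∸ 1) * ((n ∸ 2) C k)
  C-double-absorption zero k = trans (cong (suc k *_) (*-zeroʳ (suc (suc k)))) (*-zeroʳ (suc k))
  C-double-absorption (suc zero) k = trans (cong (suc k *_) (*-zeroʳ (suc (suc k)))) (*-zeroʳ (suc k))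
  C-double-absorption (suc (suc m)) k = begin
    suc k * (suc (suc k) * (suc (suc m) C suc (suc k))) ≡⟨ cong (suc k *_) (C-absorption (suc m) (suc k)) ⟩
    suc k * (suc (suc m) * (suc m C suc k))             ≡⟨ swap (suc k) (suc (suc m)) (suc m C suc k) ⟩
    suc (suc m) * (suc k * (suc m C suc k))             ≡⟨ cong (suc (suc m) *_) (C-absorption m k) ⟩
    suc (suc m) * (suc m * (m C k))                     ≡⟨ *-assoc (suc (suc m)) (suc m) (m C k) ⟨
    suc (suc m) * suc m * (m C k)                       ∎
    where
    open ≡-Reasoning
    swap : ∀ a b c → a * (b * c) ≡ b * (a * c)
    swap = solve-∀

module Density where

  open import Defs using (AtLeastEOver36; ePartial)
  open import Data.Nat as ℕ using (ℕ; zero; suc)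
  import Data.Nat.Properties as ℕ
  open import Data.Nat.Coprimality using (1-coprimeTo; sym)
  open import Data.Integer as ℤ using (+_)
  import Data.Integer.Properties as ℤ
  open import Data.Rational
  open import Data.Rational.Properties
  import Data.Rational.Unnormalised as ℚᵘ
  import Data.Rational.Unnormalised.Properties as ℚᵘ
  open import Data.Rational.Solver using (module +-*-Solver)
  open import Relation.Nullary.Decidable using (toWitness)
  open import Data.Empty using (⊥-elim)
  open import Relation.Binary.PropositionalEquality
    using (_≡_; refl; cong; subst₂) renaming (sym to ≡-sym; trans to ≡-trans)
  open +-*-Solver using (solve; _:+_; _:*_; _:=_; con)

  toℚ : ℕ → ℚ
  toℚ m = + m / 1

  toℚᵘ-toℚ : ∀ m → toℚᵘ (toℚ m) ≡ ℚᵘ.mkℚᵘ (+ m) 0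
  toℚᵘ-toℚ m = cong toℚᵘ (normalize-coprime (sym (1-coprimeTo m)))

  toℚ-+ : ∀ a b → toℚ (a ℕ.+ b) ≡ toℚ a + toℚ b
  toℚ-+ a b = toℚᵘ-injective (ℚᵘ.≃-trans homo (ℚᵘ.≃-sym (toℚᵘ-homo-+ (toℚ a) (toℚ b))))
    where
    homo : toℚᵘ (toℚ (a ℕ.+ b)) ℚᵘ.≃ toℚᵘ (toℚ a) ℚᵘ.+ toℚᵘ (toℚ b)
    homo rewrite toℚᵘ-toℚ a | toℚᵘ-toℚ b | toℚᵘ-toℚ (a ℕ.+ b)
               | ℕ.*-identityʳ a | ℕ.*-identityʳ b | ℤ.+◃n≡+n a | ℤ.+◃n≡+n b
      = ℚᵘ.*≡* (cong (ℤ._* + 1) (ℤ.pos-+ a b))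

  toℚ-* : ∀ a b → toℚ (a ℕ.* b) ≡ toℚ a * toℚ b
  toℚ-* a b = toℚᵘ-injective (ℚᵘ.≃-trans homo (ℚᵘ.≃-sym (toℚᵘ-homo-* (toℚ a) (toℚ b))))
    where
    homo : toℚᵘ (toℚ (a ℕ.* b)) ℚᵘ.≃ toℚᵘ (toℚ a) ℚᵘ.* toℚᵘ (toℚ b)
    homo rewrite toℚᵘ-toℚ a | toℚᵘ-toℚ b | toℚᵘ-toℚ (a ℕ.* b)
      = ℚᵘ.*≡* (cong (ℤ._* + 1) (ℤ.pos-* a b))

  toℚ-cancel-≤ : ∀ {a b} → toℚ a ≤ toℚ b → a ℕ.≤ b
  toℚ-cancel-≤ {a} {b} a≤b with toℚᵘ-mono-≤ a≤b
  ... | a≤ᵘb rewrite toℚᵘ-toℚ a | toℚᵘ-toℚ b with a≤ᵘb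
  ... | ℚᵘ.*≤* a*1≤b*1 = ℤ.drop‿+≤+ (subst₂ ℤ._≤_ (ℤ.*-identityʳ (+ a)) (ℤ.*-identityʳ (+ b)) a*1≤b*1)

  toℚ-mono-≤ : ∀ {a b} → a ℕ.≤ b → toℚ a ≤ toℚ b
  toℚ-mono-≤ {a} {b} a≤b = toℚᵘ-cancel-≤ (subst₂ ℚᵘ._≤_ (≡-sym (toℚᵘ-toℚ a)) (≡-sym (toℚᵘ-toℚ b))
    (ℚᵘ.*≤* (subst₂ ℤ._≤_ (≡-sym (ℤ.*-identityʳ (+ a))) (≡-sym (ℤ.*-identityʳ (+ b))) (ℤ.+≤+ a≤b))))

  0≤toℚ : ∀ m → 0ℚ ≤ toℚ m
  0≤toℚ m = toℚ-mono-≤ {0} {m} ℕ.z≤n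

  1≤17c : ∀ {c} → AtLeastEOver36 c → 1ℚ ≤ toℚ 17 * c
  1≤17c {c} e≤36c = *-cancelˡ-≤-pos (toℚ 36) (begin
    toℚ 36 * 1ℚ            ≤⟨ toWitness {a? = toℚ 36 * 1ℚ ≤? toℚ 17 * ePartial 2} _ ⟩
    toℚ 17 * ePartial 2    ≤⟨ *-monoˡ-≤-nonNeg (toℚ 17) (e≤36c 2) ⟩
    toℚ 17 * (toℚ 36 * c)  ≡⟨ solve 1 (λ c → con (toℚ 17) :* (con (toℚ 36) :* c)
                                            := con (toℚ 36) :* (con (toℚ 17) :* c)) refl c ⟩
    toℚ 36 * (toℚ 17 * c)  ∎)
    where open ≤-Reasoning

  0≤* : ∀ {a b} → 0ℚ ≤ a → 0ℚ ≤ b → 0ℚ ≤ a * b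
  0≤* {a} {b} 0≤a 0≤b = nonNegative⁻¹ (a * b) {{nonNeg*nonNeg⇒nonNeg a {{nonNegative 0≤a}} b {{nonNegative 0≤b}}}}

  density-bound : ∀ {c x m e} → 1ℚ ≤ toℚ 17 * c → 0ℚ ≤ x → 0ℚ ≤ m →
    toℚ 18 * c * x < m → e ≤ c * m → x * (m + e) ≤ m * m
  density-bound {c} {x} {m} {e} 1≤17c 0≤x 0≤m 18cx<m e≤cm = begin
    x * (m + e)            ≤⟨ *-monoˡ-≤-nonNeg x {{nonNegative 0≤x}} (+-monoʳ-≤ m e≤cm) ⟩
    x * (m + c * m)        ≡⟨ solve 3 (λ c x m → x :* (m :+ c :* m) := x :* m :* (con 1ℚ :+ c)) refl c x m ⟩
    x * m * (1ℚ + c)       ≤⟨ *-monoˡ-≤-nonNeg (x * m) {{nonNegative (0≤* 0≤x 0≤m)}} 1+c≤18c ⟩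
    x * m * (toℚ 18 * c)   ≡⟨ solve 3 (λ c x m → x :* m :* (con (toℚ 18) :* c) := con (toℚ 18) :* c :* x :* m) refl c x m ⟩
    toℚ 18 * c * x * m     ≤⟨ *-monoʳ-≤-nonNeg m {{nonNegative 0≤m}} (<⇒≤ 18cx<m) ⟩
    m * m                  ∎
    where
    open ≤-Reasoning
    1+c≤18c : 1ℚ + c ≤ toℚ 18 * c
    1+c≤18c = ≤-trans (+-monoˡ-≤ c 1≤17c)
      (≤-reflexive (solve 1 (λ c → con (toℚ 17) :* c :+ c := con (toℚ 18) :* c) refl c))

  cube-density-bound : ∀ r n E c → AtLeastEOver36 c →
    toℚ 18 * c * toℚ (r ℕ.^ 3) < toℚ n → toℚ E ≤ c * toℚ n →
    r ℕ.^ 3 ℕ.* (n ℕ.+ E) ℕ.≤ n ℕ.* n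
  cube-density-bound r n E c e≤36c 18cr³<n E≤cn = toℚ-cancel-≤ (begin
    toℚ (r ℕ.^ 3 ℕ.* (n ℕ.+ E))
      ≡⟨ ≡-trans (toℚ-* (r ℕ.^ 3) (n ℕ.+ E)) (cong (toℚ (r ℕ.^ 3) *_) (toℚ-+ n E)) ⟩
    toℚ (r ℕ.^ 3) * (toℚ n + toℚ E)
      ≤⟨ density-bound {c} (1≤17c {c} e≤36c) (0≤toℚ (r ℕ.^ 3)) (0≤toℚ n) 18cr³<n E≤cn ⟩
    toℚ n * toℚ n
      ≡⟨ toℚ-* n n ⟨
    toℚ (n ℕ.* n) ∎)
    where open ≤-Reasoning

  density-positive : ∀ x n c → AtLeastEOver36 c → toℚ 18 * c * toℚ x < toℚ n → 0 ℕ.< n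
  density-positive x zero c e≤36c 18cx<0 = ⊥-elim (<-irrefl refl (≤-<-trans 0≤18cx 18cx<0))
    where
    0≤c : 0ℚ ≤ c
    0≤c = *-cancelˡ-≤-pos (toℚ 17) (≤-trans (toWitness {a? = toℚ 17 * 0ℚ ≤? 1ℚ} _) (1≤17c {c} e≤36c))
    0≤18cx : 0ℚ ≤ toℚ 18 * c * toℚ x
    0≤18cx = 0≤* (0≤* (0≤toℚ 18) 0≤c) (0≤toℚ x)
  density-positive x (suc n) _ _ _ = ℕ.s≤s ℕ.z≤n

module Inequality where

  open import Data.Nat
  open import Data.Nat.Properties
  open import Data.Nat.Tactic.RingSolver using (solve-∀)
  open import Relation.Binary.PropositionalEquality using (_≡_; cong)

  k[r²n+rE]+n≤r³[n+E] : ∀ k n E → k * (suc k * suc k * n + suc k * E) + n ≤ suc k ^ 3 * (n + E)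
  k[r²n+rE]+n≤r³[n+E] k n E = begin
    k * (suc k * suc k * n + suc k * E) + n
      ≤⟨ m≤m+n _ (k * (k + 2) * n + suc k * (k * k + k + 1) * E) ⟩
    k * (suc k * suc k * n + suc k * E) + n + (k * (k + 2) * n + suc k * (k * k + k + 1) * E)
      ≡⟨ expand k n E ⟩
    suc k ^ 3 * (n + E) ∎
    where
    open ≤-Reasoning
    expand : ∀ k n E → k * (suc k * suc k * n + suc k * E) + n + (k * (k + 2) * n + suc k * (k * k + k + 1) * E)
                       ≡ suc k * (suc k * (suc k * 1)) * (n + E)
    expand = solve-∀

  -- L = |F|, B = C(n-2, k), N = number of independent r-sets, Cnr = C(n, r), s = s_r(v).
  counting-bounds⇒L≤s : ∀ k n′ E B N Cnr s L → let r = suc (suc k) ; n = suc n′ in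
    L ≤ r * (r * B) →
    Cnr ≤ N + E * B →
    N * r ≤ n * s →
    suc k * (r * Cnr) ≡ n * (n ∸ 1) * B →
    suc k * (r * r * n + r * E) + n ≤ n * n →
    L ≤ s
  counting-bounds⇒L≤s k n′ E B N Cnr s L L≤ Cnr≤ Nr≤ absorption density =
    ≤-trans L≤ (*-cancelˡ-≤ n (≤-trans n*rrB≤r*N (≤-trans (≤-reflexive (*-comm r N)) Nr≤)))
    where
    r = suc (suc k)
    n = suc n′
    K = suc k
    open ≤-Reasoning
    key : K * (n * (r * (r * B))) + K * (r * (E * B)) + n * B ≤ K * (r * N) + K * (r * (E * B)) + n * B
    key = begin
      K * (n * (r * (r * B))) + K * (r * (E * B)) + n * B  ≡⟨ lhs K r n E B ⟩
      (K * (r * r * n + r * E) + n) * B                    ≤⟨ *-monoˡ-≤ B density ⟩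
      n * n * B                                            ≡⟨ split n′ B ⟩
      n * (n ∸ 1) * B + n * B                              ≡⟨ cong (_+ n * B) absorption ⟨
      K * (r * Cnr) + n * B                                ≤⟨ +-monoˡ-≤ (n * B) (*-monoʳ-≤ K (*-monoʳ-≤ r Cnr≤)) ⟩
      K * (r * (N + E * B)) + n * B                        ≡⟨ rhs K r N (E * B) (n * B) ⟩
      K * (r * N) + K * (r * (E * B)) + n * B              ∎
      where
      lhs : ∀ K r n E B → K * (n * (r * (r * B))) + K * (r * (E * B)) + n * B ≡ (K * (r * r * n + r * E) + n) * B
      lhs = solve-∀
      split : ∀ n′ B → suc n′ * suc n′ * B ≡ suc n′ * n′ * B + suc n′ * B
      split = solve-∀
      rhs : ∀ K r N X Y → K * (r * (N + X)) + Y ≡ K * (r * N) + K * (r * X) + Y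
      rhs = solve-∀
    n*rrB≤r*N : n * (r * (r * B)) ≤ r * N
    n*rrB≤r*N = *-cancelˡ-≤ K (+-cancelʳ-≤ _ _ _ (+-cancelʳ-≤ _ _ _ key))

module IntersectingFamilies where

  open Counting
  open Subsets
  open import Defs hiding (sym)
  open import Data.Nat using (ℕ; zero; suc; _+_; _*_; _∸_; _≤_; _<_; _<?_; _≟_; z≤n; s≤s)
  open import Data.Nat.Properties using (≤-trans; ≤-reflexive; <-irrefl; +-comm; +-monoʳ-≤; <-cmp; module ≤-Reasoning)
  open import Data.Nat.Combinatorics using (_C_)
  open import Data.Fin using (Fin; zero; toℕ)
  open import Data.Fin.Properties using (any?; toℕ-injective)
  open import Data.Fin.Subset using (Subset; _∈_; _∉_; ∣_∣)
  open import Data.Fin.Subset.Properties using (_∈?_)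
  open import Data.List using (List; map; filter; length; allFin; cartesianProduct)
  open import Data.List.Properties using (map-cong; length-tabulate)
  open import Data.List.Extrema.Nat using (argmax; f[xs]≤f[argmax])
  open import Data.Nat.ListAction using (sum)
  open import Function using (id)
  open import Data.List.Membership.Propositional using (find) renaming (_∈_ to _∈ₗ_)
  open import Data.List.Membership.Propositional.Properties using (∈-filter⁺; ∈-filter⁻; ∈-allFin; ∈-cartesianProduct⁺)
  open import Data.List.Relation.Unary.All as All using (All)
  open import Data.List.Relation.Unary.All.Properties using (¬All⇒Any¬; all-filter)
  import Data.List.Relation.Unary.Unique.Propositional.Properties as Unique
  open import Data.Product using (∃; _×_; _,_; proj₁; proj₂)
  open import Data.Sum using (_⊎_; inj₁; inj₂)
  open import Data.Bool using (true)
  import Data.Bool.Properties as Bool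
  open import Relation.Binary.Definitions using (tri<; tri≈; tri>)
  open import Relation.Nullary using (Dec; ¬_; yes; no; contradiction)
  open import Relation.Nullary.Decidable using (_×-dec_)
  open import Relation.Unary.Properties using (∁?)
  open import Relation.Binary.PropositionalEquality using (_≡_; _≢_; refl; sym; trans; cong; subst)

  NonStar : ∀ {n} → List (Subset n) → Set
  NonStar F = ∀ v → ¬ All (v ∈_) F

  avoiding-member : ∀ {n} {F : List (Subset n)} → NonStar F → ∀ v → ∃ λ D → D ∈ₗ F × v ∉ D
  avoiding-member {F = F} nonStar v = find (¬All⇒Any¬ (v ∈?_) F (nonStar v))

  module _ {n : ℕ} (G : Graph n) where

    star : ℕ → Fin n → List (Subset n)
    star r v = filter (λ S → indepSet? G r S ×-dec (v ∈? S)) (allSubsets n)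

    star-intersecting : ∀ r v → IsIntersectingSubfamily G r (star r v)
    star-intersecting r v =
      Unique.filter⁺ _ (allSubsets-unique n) , All.map proj₁ members ,
      All⇒AllPairs (λ (_ , v∈S) (_ , v∈T) → v , v∈S , v∈T) members
      where members = all-filter (λ S → indepSet? G r S ×-dec (v ∈? S)) (allSubsets n)

    s≤maximum : ∀ {r F} → IsMaxIntersecting G r F → ∀ v → s G r v ≤ length F
    s≤maximum (_ , maximum) v = maximum (star _ v) (star-intersecting _ v)

    length≤s : ∀ {r F} v → IsIntersectingSubfamily G r F → All (v ∈_) F → length F ≤ s G r v
    length≤s {r} v (unique , independent , _) v∈F =
      Unique⇒length≤# (λ S → indepSet? G r S ×-dec (v ∈? S)) unique (All.zip (independent , v∈F))

    members-intersect : ∀ {r F S T} → 0 < r → IsIntersectingSubfamily G r F → S ∈ₗ F → T ∈ₗ F → Intersect S T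
    members-intersect 0<r (_ , independent , pairwise) S∈F T∈F with AllPairs-lookup pairwise S∈F T∈F
    ... | inj₁ refl = let (x , x∈S) = 0<∣S∣⇒Nonempty (subst (0 <_) (sym (proj₂ (All.lookup independent S∈F))) 0<r)
                      in x , x∈S , x∈S
    ... | inj₂ (inj₁ S∩T) = S∩T
    ... | inj₂ (inj₂ (x , x∈T , x∈S)) = x , x∈S , x∈T

    r≡1⇒¬NonStar : ∀ {F A} → IsIntersectingSubfamily G 1 F → A ∈ₗ F → ¬ NonStar F
    r≡1⇒¬NonStar {F} {A} isF@(_ , independent , _) A∈F nonStar =
      let ∣A∣≡1 = proj₂ (All.lookup independent A∈F)
          (a , a∈A) = 0<∣S∣⇒Nonempty {S = A} (subst (0 <_) (sym ∣A∣≡1) (s≤s z≤n))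
          (D , D∈F , a∉D) = avoiding-member nonStar a
          (b , b∈A , b∈D) = members-intersect (s≤s z≤n) isF A∈F D∈F
      in a∉D (subst (_∈ D) (∣S∣≡1⇒∈-unique ∣A∣≡1 b∈A a∈A) b∈D)

    module _ (k : ℕ) {F : List (Subset n)} (isF : IsIntersectingSubfamily G (2 + k) F) (nonStar : NonStar F) where

      private
        unique = proj₁ isF
        sized : ∀ {S} → S ∈ₗ F → ∣ S ∣ ≡ 2 + k
        sized S∈F = proj₂ (All.lookup (proj₁ (proj₂ isF)) S∈F)

      nonStar-degree≤ : ∀ a → count (a ∈?_) F ≤ (2 + k) * ((n ∸ 2) C k)
      nonStar-degree≤ a = subst (λ m → length Fa ≤ m * ((n ∸ 2) C k)) (trans (length-elements D) (sized D∈F))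
        (union-bound (λ b → b ∈?_) ((n ∸ 2) C k) (elements D) Fa covered bounded)
        where
        Fa = filter (a ∈?_) F
        D = proj₁ (avoiding-member nonStar a)
        D∈F = proj₁ (proj₂ (avoiding-member nonStar a))
        a∉D = proj₂ (proj₂ (avoiding-member nonStar a))
        covered : ∀ {S} → S ∈ₗ Fa → ∃ λ b → b ∈ₗ elements D × b ∈ S
        covered S∈Fa with members-intersect (s≤s z≤n) isF (proj₁ (∈-filter⁻ (a ∈?_) S∈Fa)) D∈F
        ... | b , b∈S , b∈D = b , ∈-elements b∈D , b∈S
        bounded : ∀ {b} → b ∈ₗ elements D → count (b ∈?_) Fa ≤ (n ∸ 2) C k
        bounded {b} b∈ = ≤-trans
          (Unique⇒length≤# (superset? (pair a b) (k + 2)) (Unique.filter⁺ _ (Unique.filter⁺ _ unique))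
            (All.tabulate λ S∈ → let (S∈Fa , b∈S) = ∈-filter⁻ (b ∈?_) S∈ ; (S∈F , a∈S) = ∈-filter⁻ (a ∈?_) S∈Fa
                                 in trans (sized S∈F) (+-comm 2 k) , pair⊆ a∈S b∈S))
          (≤-reflexive (#supersets-pair n k a≢b))
          where
          a≢b : a ≢ b
          a≢b refl = a∉D (proj₂ (∈-filter⁻ (_∈? D) {xs = allFin n} b∈))

      nonStar-length≤ : ∀ {A} → A ∈ₗ F → length F ≤ (2 + k) * ((2 + k) * ((n ∸ 2) C k))
      nonStar-length≤ {A} A∈F = subst (λ m → length F ≤ m * ((2 + k) * ((n ∸ 2) C k))) (trans (length-elements A) (sized A∈F))
        (union-bound (λ a → a ∈?_) _ (elements A) F covered (λ {a} _ → nonStar-degree≤ a))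
        where
        covered : ∀ {S} → S ∈ₗ F → ∃ λ a → a ∈ₗ elements A × a ∈ S
        covered S∈F with members-intersect (s≤s z≤n) isF S∈F A∈F
        ... | a , a∈S , a∈A = a , ∈-elements a∈A , a∈S

    IsEdge : Fin n × Fin n → Set
    IsEdge (i , j) = (toℕ i < toℕ j) × Adjacent G i j

    isEdge? : (e : Fin n × Fin n) → Dec (IsEdge e)
    isEdge? (i , j) = (toℕ i <? toℕ j) ×-dec (adj G i j Bool.≟ true)

    edges : List (Fin n × Fin n)
    edges = filter isEdge? (cartesianProduct (allFin n) (allFin n))

    adjacent⇒edge : ∀ {i j} → Adjacent G i j → (i , j) ∈ₗ edges ⊎ (j , i) ∈ₗ edges
    adjacent⇒edge {i} {j} i~j with <-cmp (toℕ i) (toℕ j)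
    ... | tri< i<j _ _ = inj₁ (∈-filter⁺ isEdge? (∈-cartesianProduct⁺ (∈-allFin i) (∈-allFin j)) (i<j , i~j))
    ... | tri≈ _ i≡j _ = contradiction (trans (sym i~i) (irrefl G i)) λ ()
      where
      i~i : Adjacent G i i
      i~i = subst (Adjacent G i) (sym (toℕ-injective i≡j)) i~j
    ... | tri> _ _ j<i =
      inj₂ (∈-filter⁺ isEdge? (∈-cartesianProduct⁺ (∈-allFin j) (∈-allFin i)) (j<i , trans (Graph.sym G j i) i~j))

    dependent⇒edge : ∀ {S} → ¬ Independent G S → ∃ λ e → e ∈ₗ edges × proj₁ e ∈ S × proj₂ e ∈ S
    dependent⇒edge {S} dependent
      with any? (λ i → any? (λ j → (i ∈? S) ×-dec ((j ∈? S) ×-dec (adj G i j Bool.≟ true))))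
    ... | no none = contradiction (λ i j i∈S j∈S i~j → none (i , j , i∈S , j∈S , i~j)) dependent
    ... | yes (i , j , i∈S , j∈S , i~j) with adjacent⇒edge i~j
    ...   | inj₁ ij∈edges = (i , j) , ij∈edges , i∈S , j∈S
    ...   | inj₂ ji∈edges = (j , i) , ji∈edges , j∈S , i∈S

    C≤independent+edges*C : ∀ k → n C (2 + k) ≤ # (indepSet? G (2 + k)) + numEdges G * ((n ∸ 2) C k)
    C≤independent+edges*C k = begin
      n C r                                            ≡⟨ #size≡C n r ⟨
      length sized                                     ≡⟨ count+count-∁≡length (independent? G) sized ⟨
      count (independent? G) sized + length dependent  ≡⟨ cong (_+ length dependent) independent-count ⟩
      # (indepSet? G r) + length dependent             ≤⟨ +-monoʳ-≤ _ dependent-count ⟩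
      # (indepSet? G r) + numEdges G * ((n ∸ 2) C k)   ∎
      where
      open ≤-Reasoning
      r = 2 + k
      sized = filter (λ S → ∣ S ∣ ≟ r) (allSubsets n)
      dependent = filter (∁? (independent? G)) sized
      independent-count : count (independent? G) sized ≡ # (indepSet? G r)
      independent-count = trans (count-filter (λ S → ∣ S ∣ ≟ r) (independent? G) (allSubsets n))
        (count-≐ _ (indepSet? G r) ((λ (a , b) → b , a) , (λ (a , b) → b , a)) (allSubsets n))
      covered : ∀ {S} → S ∈ₗ dependent → ∃ λ e → e ∈ₗ edges × proj₁ e ∈ S × proj₂ e ∈ S
      covered S∈ = dependent⇒edge (proj₂ (∈-filter⁻ (∁? (independent? G)) {xs = sized} S∈))
      bounded : ∀ {e} → e ∈ₗ edges → count (λ S → (proj₁ e ∈? S) ×-dec (proj₂ e ∈? S)) dependent ≤ (n ∸ 2) C k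
      bounded {i , j} e∈edges = ≤-trans
        (Unique⇒length≤# (superset? (pair i j) (k + 2))
          (Unique.filter⁺ _ (Unique.filter⁺ _ (Unique.filter⁺ _ (allSubsets-unique n))))
          (All.tabulate λ S∈ → let (S∈dep , i∈S , j∈S) = ∈-filter⁻ (λ S → (i ∈? S) ×-dec (j ∈? S)) S∈
                                   (S∈sized , _) = ∈-filter⁻ (∁? (independent? G)) S∈dep
                                   (_ , ∣S∣≡r) = ∈-filter⁻ (λ S → ∣ S ∣ ≟ r) {xs = allSubsets n} S∈sized
                               in trans ∣S∣≡r (+-comm 2 k) , pair⊆ i∈S j∈S))
        (≤-reflexive (#supersets-pair n k i≢j))
        where
        i≢j : i ≢ j
        i≢j refl = <-irrefl refl (proj₁ (proj₂ (∈-filter⁻ isEdge? {xs = cartesianProduct (allFin n) (allFin n)} e∈edges)))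
      dependent-count : length dependent ≤ numEdges G * ((n ∸ 2) C k)
      dependent-count = union-bound (λ e S → (proj₁ e ∈? S) ×-dec (proj₂ e ∈? S)) _ edges dependent covered bounded

  N*r≤n*s-somewhere : ∀ {n′} (G : Graph (suc n′)) r → ∃ λ v → # (indepSet? G r) * r ≤ suc n′ * s G r v
  N*r≤n*s-somewhere {n′} G r = v , (begin
    length I * r
      ≡⟨ sum-map-const (λ S → count (_∈? S) (allFin n)) (All.tabulate ∣S∣≡r) ⟨
    sum (map (λ S → count (_∈? S) (allFin n)) I)
      ≡⟨ double-count (λ v S → v ∈? S) (allFin n) I ⟩
    sum (map (λ v → count (v ∈?_) I) (allFin n))
      ≡⟨ cong sum (map-cong (λ v → count-filter (indepSet? G r) (v ∈?_) (allSubsets n)) (allFin n)) ⟩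
    sum (map (s G r) (allFin n))
      ≤⟨ sum-map-≤ (s G r) (allFin n) (All.lookup (f[xs]≤f[argmax] {f = s G r} zero (allFin n))) ⟩
    length (allFin n) * s G r v
      ≡⟨ cong (_* s G r v) (length-tabulate {n = n} id) ⟩
    n * s G r v ∎)
    where
    open ≤-Reasoning
    n = suc n′
    I = filter (indepSet? G r) (allSubsets n)
    v = argmax (s G r) zero (allFin n)
    ∣S∣≡r : ∀ {S} → S ∈ₗ I → length (elements S) ≡ r
    ∣S∣≡r {S} S∈I = trans (length-elements S) (proj₂ (proj₂ (∈-filter⁻ (indepSet? G r) {xs = allSubsets n} S∈I)))

open import Defs
open import Data.Nat using (ℕ; _<_; _^_)
open import Data.Integer using (+_)
open import Data.Rational using (ℚ; _/_; _*_; _≤_)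
import Data.Rational

import Data.Nat as ℕ
open import Data.Nat.Properties using (≤-antisym; ≤-trans)
open import Data.Nat.Combinatorics using (_C_)
open import Data.Fin using (zero)
open import Data.Fin.Properties using (any?)
open import Data.Fin.Subset.Properties using (_∈?_)
open import Data.List using ([]; _∷_; length)
open import Data.List.Relation.Unary.All using (all?; [])
open import Data.List.Relation.Unary.Any using (here)
open import Data.Product using (∃; _,_; proj₁; proj₂)
open import Relation.Nullary using (yes; no; contradiction)
open import Relation.Binary.PropositionalEquality using (_≡_; refl)
open Subsets using (#_)
open Binomial
open Density
open Inequality
open IntersectingFamilies

nonStar-EKR : (r : ℕ) → 0 < r → (c : ℚ) → AtLeastEOver36 c → (n : ℕ) → (G : Graph n) →
  (+ 18 / 1) * c * (+ (r ^ 3) / 1) Data.Rational.< (+ n / 1) →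
  (+ numEdges G / 1) ≤ c * (+ n / 1) →
  ∀ F → IsMaxIntersecting G r F → NonStar F → ∃ λ v → s G r v ≡ length F
nonStar-EKR ℕ.zero () _ _ _ _ _ _ _ _ _
nonStar-EKR r _ c e≤36c ℕ.zero G 18cr³<0 _ _ _ _ = contradiction (density-positive (r ^ 3) ℕ.zero c e≤36c 18cr³<0) λ ()
nonStar-EKR r _ _ _ (ℕ.suc _) G _ _ [] _ nonStar = contradiction [] (nonStar zero)
nonStar-EKR 1 _ _ _ (ℕ.suc _) G _ _ (_ ∷ _) (isF , _) nonStar = contradiction nonStar (r≡1⇒¬NonStar G isF (here refl))
nonStar-EKR (ℕ.suc (ℕ.suc k)) _ c e≤36c n@(ℕ.suc n′) G 18cr³<n E≤cn F@(_ ∷ _) isMax@(isF , _) nonStar =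
  v , ≤-antisym (s≤maximum G isMax v)
        (counting-bounds⇒L≤s k n′ E ((n ℕ.∸ 2) C k) (# (indepSet? G r)) (n C r) (s G r v) (length F)
          (nonStar-length≤ G k isF nonStar (here refl))
          (C≤independent+edges*C G k)
          N*r≤n*s
          (C-double-absorption n k)
          (≤-trans (k[r²n+rE]+n≤r³[n+E] (ℕ.suc k) n E) (cube-density-bound r n E c e≤36c 18cr³<n E≤cn)))
  where
  r = ℕ.suc (ℕ.suc k)
  E = numEdges G
  v = proj₁ (N*r≤n*s-somewhere G r)
  N*r≤n*s = proj₂ (N*r≤n*s-somewhere G r)

theorem2p2 : (r : ℕ) → 0 < r → (c : ℚ) → AtLeastEOver36 c →
    (n : ℕ) → (G : Graph n) →
    (+ 18 / 1) * c * (+ (r ^ 3) / 1) Data.Rational.< (+ n / 1) →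
    (+ numEdges G / 1) ≤ c * (+ n / 1) →
    EKR r G
theorem2p2 r 0<r c e≤36c n G 18cr³<n E≤cn F isMax@(isF , _) with any? (λ v → all? (v ∈?_) F)
... | yes (v , v∈F) = v , ≤-antisym (s≤maximum G isMax v) (length≤s G v isF v∈F)
... | no noStar = nonStar-EKR r 0<r c e≤36c n G 18cr³<n E≤cn F isMax (λ v v∈F → noStar (v , v∈F))
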